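{- Let $S=\{a_0,a_1,a_2,\ldots\}$ and $T=\{b_0,b_1,b_2,\ldots\}$ be sets of positive integers listed in strictly increasing order ($a_0<a_1<a_2<\cdots$, $b_0<b_1<b_2<\cdots$) such that $a_i \geq b_i$ for all $i\geq 0$. Then for every positive integer $n$, $$r_S(n) \leq r_T(n),$$ where for a set $X$ of positive integers, $r_X(n)$ denotes the number of partitions of perimeter $n$ all of whose parts lie in $X$.
   Context: A partition is a finite nonincreasing sequence of positive integers (its parts); partitions of any size are allowed. For a partition $\pi$ with largest part $\alpha(\pi)$ and number of parts $\lambda(\pi)$, its perimeter is $\alpha(\pi)+\lambda(\pi)-1$. -}

module Defs where

open import Data.Nat using (ℕ; zero; suc; _+_; _∸_; _≤_; _<_; _≥_; _⊔_)
open import Data.List using (List; []; _∷_; length; foldr)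
open import Data.List.Relation.Unary.All using (All)
open import Data.List.Relation.Unary.Linked using (Linked)
open import Data.Product using (Σ; ∃; _×_)
open import Data.Fin using (Fin)
open import Function.Bundles using (_↔_)
open import Relation.Binary.PropositionalEquality using (_≡_)

record Partition : Set where
  constructor mkPartition
  field
    parts       : List ℕ
    nonempty    : 1 ≤ length parts
    positive    : All (λ x → 0 < x) parts
    nonincrease : Linked _≥_ parts
open Partition public

largestPart : Partition → ℕ
largestPart π = foldr _⊔_ 0 (parts π)

numParts : Partition → ℕ
numParts π = length (parts π)

perimeter : Partition → ℕ
perimeter π = largestPart π + numParts π ∸ 1

StrictlyIncreasing : (ℕ → ℕ) → Set
StrictlyIncreasing a = ∀ i → a i < a (suc i)

Positive : (ℕ → ℕ) → Set
Positive a = ∀ i → 0 < a i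

-- membership in the set X = {a 0, a 1, a 2, ...}
_∈Seq_ : ℕ → (ℕ → ℕ) → Set
x ∈Seq a = ∃ λ i → a i ≡ x

PerimParts : (ℕ → ℕ) → ℕ → Set
PerimParts a n = Σ Partition λ π → (perimeter π ≡ n) × All (λ x → x ∈Seq a) (parts π)

-- "r_X(n) = c": c is the number of such partitions (Fin c is in bijection with them)
IsCount : (ℕ → ℕ) → ℕ → ℕ → Set
IsCount a n c = Fin c ↔ PerimParts a n

{-# OPTIONS --safe #-}
-- Encode a partition with parts in S by the nonincreasing list of indices of its parts,
-- j ∷ is with largest part a j; its perimeter is a j + length is.  Reading the same
-- indices in T and appending a j ∸ b j copies of index 0 (that is, parts b 0) gives a
-- partition with parts in T of perimeter b j + length is + (a j ∸ b j) = a j + length is.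
-- Index 0 is the smallest, so the list stays nonincreasing and the largest index is still
-- j; cancelling the padding recovers the original, so the map is injective.
module Submission where

open import Defs
open import Data.Nat using (ℕ; zero; suc; _+_; _∸_; _⊔_; _≤_; _<_; _≥_; _≤′_; ≤′-refl; ≤′-step; z≤n; s≤s)
open import Data.Nat.Properties
open import Data.List using (List; []; _∷_; _++_; length; map; replicate; foldr)
open import Data.List.Properties using (length-map; length-++; length-replicate; ++-cancelʳ)
open import Data.List.Relation.Unary.All as All using (All; []; _∷_)
import Data.List.Relation.Unary.All.Properties as All
open import Data.List.Relation.Unary.Linked as Linked using (Linked; []; [-]; _∷_)
import Data.List.Relation.Unary.Linked.Properties as Linked
open import Data.Product using (_,_; proj₁)
open import Data.Fin using (Fin)
open import Data.Fin.Properties using (injective⇒≤)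
open import Function using (_∘_)
open import Function.Bundles using (_↔_; _↣_; Injection; mk↔ₛ′; mk↣)
open import Function.Definitions using (Injective)
open import Function.Construct.Composition using (_↣-∘_)
open import Function.Properties.Inverse using (↔⇒↣; ↔-sym)
open import Relation.Binary.PropositionalEquality
open import Relation.Unary using (Irrelevant)

foldr-⊔-nonincreasing : ∀ {x xs} → Linked _≥_ (x ∷ xs) → foldr _⊔_ 0 (x ∷ xs) ≡ x
foldr-⊔-nonincreasing = m≥n⇒m⊔n≡m ∘ bounded
  where
  bounded : ∀ {x xs} → Linked _≥_ (x ∷ xs) → foldr _⊔_ 0 xs ≤ x
  bounded [-]          = z≤n
  bounded (x≥y ∷ y∷ys) = ⊔-lub x≥y (≤-trans (bounded y∷ys) x≥y)

perimeter-∷ : ∀ {x xs} ne pos (ni : Linked _≥_ (x ∷ xs)) →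
              perimeter (mkPartition (x ∷ xs) ne pos ni) ≡ x + length xs
perimeter-∷ {x} {xs} _ _ ni = trans (cong (λ m → m + suc (length xs) ∸ 1) (foldr-⊔-nonincreasing ni))
                                    (cong (_∸ 1) (+-suc x (length xs)))

++-replicate-0⁺ : ∀ c {x xs} → Linked _≥_ (x ∷ xs) → Linked _≥_ (x ∷ xs ++ replicate c 0)
++-replicate-0⁺ zero    {xs = []}    [-]        = [-]
++-replicate-0⁺ (suc c) {xs = []}    [-]        = z≤n ∷ ++-replicate-0⁺ c [-]
++-replicate-0⁺ c       {xs = _ ∷ _} (x≥y ∷ ni) = x≥y ∷ ++-replicate-0⁺ c ni

indices : ∀ {a xs} → All (_∈Seq a) xs → List ℕ
indices = All.reduce proj₁

map-indices : ∀ {a xs} (m : All (_∈Seq a) xs) → map a (indices m) ≡ xs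
map-indices []               = refl
map-indices ((_ , refl) ∷ m) = cong (_ ∷_) (map-indices m)

∈Seq-map : ∀ a is → All (_∈Seq a) (map a is)
∈Seq-map a = All.map⁺ ∘ All.universal (_, refl)

indices-∈Seq-map : ∀ a is → indices (∈Seq-map a is) ≡ is
indices-∈Seq-map a []       = refl
indices-∈Seq-map a (i ∷ is) = cong (i ∷_) (indices-∈Seq-map a is)

length-indices : ∀ {a xs} (m : All (_∈Seq a) xs) → length (indices m) ≡ length xs
length-indices m = trans (sym (length-map _ (indices m))) (cong length (map-indices m))

module StrictlyIncreasingSeq {a : ℕ → ℕ} (a-inc : StrictlyIncreasing a) where

  mono-≤′ : ∀ {i j} → i ≤′ j → a i ≤ a j
  mono-≤′ ≤′-refl        = ≤-refl
  mono-≤′ (≤′-step i≤′j) = ≤-trans (mono-≤′ i≤′j) (<⇒≤ (a-inc _))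

  mono-≤ : ∀ {i j} → i ≤ j → a i ≤ a j
  mono-≤ = mono-≤′ ∘ ≤⇒≤′

  mono-< : ∀ {i j} → i < j → a i < a j
  mono-< {i} i<j = <-≤-trans (a-inc i) (mono-≤ i<j)

  cancel-≤ : ∀ {i j} → a i ≤ a j → i ≤ j
  cancel-≤ ai≤aj = ≮⇒≥ (λ j<i → <⇒≱ (mono-< j<i) ai≤aj)

  injective : ∀ {i j} → a i ≡ a j → i ≡ j
  injective ai≡aj = ≤-antisym (cancel-≤ (≤-reflexive ai≡aj)) (cancel-≤ (≤-reflexive (sym ai≡aj)))

  ∈Seq-irrelevant : Irrelevant (_∈Seq a)
  ∈Seq-irrelevant (i , refl) (j , aj≡ai) with injective aj≡ai
  ... | refl rewrite ≡-irrelevant aj≡ai refl = refl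

  PerimParts-≡ : ∀ {n} {p q : PerimParts a n} → parts (proj₁ p) ≡ parts (proj₁ q) → p ≡ q
  PerimParts-≡ {p = mkPartition xs ne pos ni , per , m} {mkPartition .xs ne′ pos′ ni′ , per′ , m′} refl
    rewrite ≤-irrelevant ne ne′ | All.irrelevant ≤-irrelevant pos pos′
          | Linked.irrelevant ≤-irrelevant ni ni′ | ≡-irrelevant per per′
          | All.irrelevant ∈Seq-irrelevant m m′ = refl

  indices-sorted : ∀ {xs} (m : All (_∈Seq a) xs) → Linked _≥_ xs → Linked _≥_ (indices m)
  indices-sorted m = Linked.map cancel-≤ ∘ Linked.map⁻ ∘ subst (Linked _≥_) (sym (map-indices m))

record IndexPartition (a : ℕ → ℕ) (n : ℕ) : Set where
  constructor indexPartition
  field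
    top         : ℕ
    rest        : List ℕ
    sorted      : Linked _≥_ (top ∷ rest)
    perimeter-≡ : a top + length rest ≡ n
open IndexPartition

IndexPartition-≡ : ∀ {a n} {u v : IndexPartition a n} → top u ≡ top v → rest u ≡ rest v → u ≡ v
IndexPartition-≡ {u = indexPartition j is s p} {indexPartition .j .is s′ p′} refl refl
  rewrite Linked.irrelevant ≤-irrelevant s s′ | ≡-irrelevant p p′ = refl

module _ {a : ℕ → ℕ} (a-inc : StrictlyIncreasing a) (a-pos : Positive a) {n : ℕ} where
  open StrictlyIncreasingSeq a-inc

  toIndexPartition : PerimParts a n → IndexPartition a n
  toIndexPartition (mkPartition (_ ∷ _) ne pos ni , per , m@((j , refl) ∷ m′)) = record
    { top         = j
    ; rest        = indices m′
    ; sorted      = indices-sorted m ni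
    ; perimeter-≡ = trans (cong (a j +_) (length-indices m′))
                          (trans (sym (perimeter-∷ ne pos ni)) per)
    }

  fromIndexPartition : IndexPartition a n → PerimParts a n
  fromIndexPartition (indexPartition j is s per) =
    mkPartition (map a (j ∷ is)) (s≤s z≤n) pos ni
      , trans (perimeter-∷ (s≤s z≤n) pos ni) (trans (cong (a j +_) (length-map a is)) per)
      , ∈Seq-map a (j ∷ is)
    where
    pos : All (0 <_) (map a (j ∷ is))
    pos = All.map⁺ (All.universal a-pos (j ∷ is))
    ni : Linked _≥_ (map a (j ∷ is))
    ni = Linked.map⁺ (Linked.map mono-≤ s)

  perimParts↔indexPartition : PerimParts a n ↔ IndexPartition a n
  perimParts↔indexPartition = mk↔ₛ′ toIndexPartition fromIndexPartition to∘from from∘to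
    where
    to∘from : ∀ u → toIndexPartition (fromIndexPartition u) ≡ u
    to∘from (indexPartition j is _ _) = IndexPartition-≡ refl (indices-∈Seq-map a is)

    from∘to : ∀ p → fromIndexPartition (toIndexPartition p) ≡ p
    from∘to (mkPartition (_ ∷ _) _ _ _ , _ , (j , refl) ∷ m) =
      PerimParts-≡ (cong (a j ∷_) (map-indices m))

module _ {a b : ℕ → ℕ} (b≤a : ∀ i → a i ≥ b i) {n : ℕ} where

  pad : IndexPartition a n → IndexPartition b n
  pad (indexPartition j is s per) =
    indexPartition j (is ++ replicate (a j ∸ b j) 0) (++-replicate-0⁺ _ s) padded-perimeter
    where
    open ≡-Reasoning
    padded-perimeter : b j + length (is ++ replicate (a j ∸ b j) 0) ≡ n
    padded-perimeter = begin
      b j + length (is ++ replicate (a j ∸ b j) 0)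
        ≡⟨ cong (b j +_) (trans (length-++ is) (cong (length is +_) (length-replicate (a j ∸ b j)))) ⟩
      b j + (length is + (a j ∸ b j))   ≡⟨ cong (b j +_) (+-comm (length is) (a j ∸ b j)) ⟩
      b j + ((a j ∸ b j) + length is)   ≡⟨ +-assoc (b j) (a j ∸ b j) (length is) ⟨
      b j + (a j ∸ b j) + length is     ≡⟨ cong (_+ length is) (m+[n∸m]≡n (b≤a j)) ⟩
      a j + length is                   ≡⟨ per ⟩
      n                                 ∎

  pad-injective : Injective _≡_ _≡_ pad
  pad-injective {indexPartition j is _ _} {indexPartition j′ is′ _ _} pad≡ with cong top pad≡
  ... | refl = IndexPartition-≡ refl (++-cancelʳ _ is is′ (cong rest pad≡))

perimParts-↣ : ∀ {a b n} → StrictlyIncreasing a → Positive a → StrictlyIncreasing b → Positive b →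
               (∀ i → a i ≥ b i) → PerimParts a n ↣ PerimParts b n
perimParts-↣ a-inc a-pos b-inc b-pos b≤a =
  ↔⇒↣ (↔-sym (perimParts↔indexPartition b-inc b-pos)) ↣-∘
  (mk↣ (pad-injective b≤a) ↣-∘ ↔⇒↣ (perimParts↔indexPartition a-inc a-pos))

theorem1p4 : (a b : ℕ → ℕ) →
    StrictlyIncreasing a → Positive a →
    StrictlyIncreasing b → Positive b →
    (∀ i → a i ≥ b i) →
    (n : ℕ) → 0 < n →
    (rS rT : ℕ) → IsCount a n rS → IsCount b n rT →
    rS ≤ rT
theorem1p4 a b a-inc a-pos b-inc b-pos b≤a n _ rS rT countS countT =
  injective⇒≤ (Injection.injective rS↣rT)
  where
  rS↣rT : Fin rS ↣ Fin rT
  rS↣rT = ↔⇒↣ (↔-sym countT) ↣-∘ (perimParts-↣ a-inc a-pos b-inc b-pos b≤a ↣-∘ ↔⇒↣ countS)
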